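{- Let $T=(t(i,j))_{i,j\ge0}$ be a lower triangular matrix of real numbers (i.e. $t(i,j)=0$ for $j>i$) with $t(i,i)=1$ for all $i$, and for $n\ge1$ let $T_{n,1}=(t(i+1,j))_{i,j=0}^{n-1}$. Suppose there are nonzero real numbers $M_0,M_1,M_2,\dots$ such that for all $n\ge0$ $$\sum_{j=0}^{n}(-1)^{n-j}t(n,j)M_j=[n=0].$$ Then $\det T_{n,1}=M_n$ for all $n\ge1$.
   Context: $[n=0]$ equals $1$ if $n=0$ and $0$ otherwise. -}

module Defs where

open import Level using (Level)
open import Data.Nat using (ℕ; zero; suc)
open import Data.Fin using (Fin; toℕ; punchIn) renaming (zero to fzero; suc to fsuc)
open import Algebra.Bundles using (CommutativeRing)

module _ {c ℓ : Level} (R : CommutativeRing c ℓ) where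
  open CommutativeRing R

  negOnePow : ℕ → Carrier
  negOnePow zero    = 1#
  negOnePow (suc k) = - negOnePow k

  iverZero : ℕ → Carrier
  iverZero zero    = 1#
  iverZero (suc _) = 0#

  sumBelow : (ℕ → Carrier) → ℕ → Carrier
  sumBelow f zero    = 0#
  sumBelow f (suc n) = sumBelow f n + f n

  sumFin : (n : ℕ) → (Fin n → Carrier) → Carrier
  sumFin zero    f = 0#
  sumFin (suc n) f = f fzero + sumFin n (λ i → f (fsuc i))

  det : (n : ℕ) → (Fin n → Fin n → Carrier) → Carrier
  det zero    A = 1#
  det (suc n) A =
    sumFin (suc n) (λ j → negOnePow (toℕ j) * (A fzero j * det n (λ i k → A (fsuc i) (punchIn j k))))

  shiftedBlock : (ℕ → ℕ → Carrier) → (n : ℕ) → Fin n → Fin n → Carrier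
  shiftedBlock t n i j = t (suc (toℕ i)) (toℕ j)

-- Write W n = det T_{n,1}, with W 0 = 1 for the empty determinant. Since t(n,n) = 1, the
-- recursion  Σ_{j ≤ n} (-1)^{n-j} t(n,j) a_j = [n = 0]  determines the sequence a, so it
-- suffices to show that W satisfies it. T_{n,1} is lower Hessenberg with ones on the
-- superdiagonal, and expanding along its first row (t(1,0), 1, 0, …, 0) leaves two minors:
-- the matrix T_{n-1,1} of the shifted triangle t(i+1,j+1), and T_{n-1,1} of that shifted
-- triangle with its first column replaced by (t(i+2,0))_i. Allowing an arbitrary first
-- column a makes the two statements "the alternating row sums of W vanish" and "the
-- alternating row sums of the determinants with first column a give (-1)^n a_n" prove each
-- other by induction on n, passing to the shifted triangle at each step.
module Submission where

open import Defs
open import Level using (Level)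
open import Function using (_∘_)
open import Data.Nat using (ℕ; zero; suc; _∸_; _<_; _≤_; s≤s; z≤n)
open import Data.Nat.Properties using (n<1+n; m<n⇒m<1+n; n∸n≡0)
open import Data.Nat.Induction using (<-rec)
open import Data.Fin using (Fin; toℕ; punchIn) renaming (zero to fzero; suc to fsuc)
open import Relation.Nullary using (¬_)
open import Relation.Binary.PropositionalEquality using (cong)
open import Algebra.Bundles using (CommutativeRing; Ring)
import Algebra.Properties.AbelianGroup as AbelianGroupProperties
import Algebra.Properties.CommutativeSemigroup as CommutativeSemigroupProperties
import Algebra.Properties.Group as GroupProperties
import Algebra.Properties.RingWithoutOne as RingWithoutOneProperties
import Relation.Binary.Reasoning.Setoid as SetoidReasoning

module HessenbergDeterminants {c ℓ : Level} (R : CommutativeRing c ℓ) where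
  open CommutativeRing R
  open SetoidReasoning setoid
  open AbelianGroupProperties +-abelianGroup using (⁻¹-∙-comm)
  open CommutativeSemigroupProperties +-commutativeSemigroup using (interchange)
  open CommutativeSemigroupProperties *-commutativeSemigroup using (x∙yz≈y∙xz)
  open GroupProperties +-group using (ε⁻¹≈ε; ∙-cancelˡ)
  open RingWithoutOneProperties (Ring.ringWithoutOne ring) using (-‿distribˡ-*; -‿distribʳ-*)

  sumBelow-cong : ∀ n {f g : ℕ → Carrier} → (∀ j → j < n → f j ≈ g j) →
                  sumBelow R f n ≈ sumBelow R g n
  sumBelow-cong zero    f≈g = refl
  sumBelow-cong (suc n) f≈g =
    +-cong (sumBelow-cong n (λ j j<n → f≈g j (m<n⇒m<1+n j<n))) (f≈g n (n<1+n n))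

  sumBelow-suc-head : ∀ f n → sumBelow R f (suc n) ≈ f 0 + sumBelow R (f ∘ suc) n
  sumBelow-suc-head f zero    = trans (+-identityˡ _) (sym (+-identityʳ _))
  sumBelow-suc-head f (suc n) = begin
    sumBelow R f (suc n) + f (suc n)           ≈⟨ +-cong (sumBelow-suc-head f n) refl ⟩
    (f 0 + sumBelow R (f ∘ suc) n) + f (suc n) ≈⟨ +-assoc _ _ _ ⟩
    f 0 + sumBelow R (f ∘ suc) (suc n)         ∎

  sumBelow-distrib-+ : ∀ f g n →
                       sumBelow R (λ j → f j + g j) n ≈ sumBelow R f n + sumBelow R g n
  sumBelow-distrib-+ f g zero    = sym (+-identityˡ 0#)
  sumBelow-distrib-+ f g (suc n) =
    trans (+-cong (sumBelow-distrib-+ f g n) refl) (interchange _ _ _ _)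

  *-distribˡ-sumBelow : ∀ x f n → x * sumBelow R f n ≈ sumBelow R (λ j → x * f j) n
  *-distribˡ-sumBelow x f zero    = zeroʳ x
  *-distribˡ-sumBelow x f (suc n) =
    trans (distribˡ x _ _) (+-cong (*-distribˡ-sumBelow x f n) refl)

  -‿distrib-sumBelow : ∀ f n → - sumBelow R f n ≈ sumBelow R (λ j → - f j) n
  -‿distrib-sumBelow f zero    = ε⁻¹≈ε
  -‿distrib-sumBelow f (suc n) =
    trans (sym (⁻¹-∙-comm _ _)) (+-cong (-‿distrib-sumBelow f n) refl)

  sumFin-cong : ∀ n {f g : Fin n → Carrier} → (∀ j → f j ≈ g j) → sumFin R n f ≈ sumFin R n g
  sumFin-cong zero    f≈g = refl
  sumFin-cong (suc n) f≈g = +-cong (f≈g fzero) (sumFin-cong n (f≈g ∘ fsuc))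

  sumFin-zero : ∀ n {f : Fin n → Carrier} → (∀ j → f j ≈ 0#) → sumFin R n f ≈ 0#
  sumFin-zero zero    f≈0 = refl
  sumFin-zero (suc n) f≈0 = trans (+-cong (f≈0 fzero) (sumFin-zero n (f≈0 ∘ fsuc))) (+-identityˡ 0#)

  det-cong : ∀ n {A B : Fin n → Fin n → Carrier} → (∀ i j → A i j ≈ B i j) → det R n A ≈ det R n B
  det-cong zero    A≈B = refl
  det-cong (suc n) A≈B = sumFin-cong (suc n) λ j →
    *-cong (refl {negOnePow R (toℕ j)}) (*-cong (A≈B fzero j) (det-cong n (λ i k → A≈B (fsuc i) (punchIn j k))))

  shift : (ℕ → ℕ → Carrier) → ℕ → ℕ → Carrier
  shift t i j = t (suc i) (suc j)

  record Unitriangular (t : ℕ → ℕ → Carrier) : Set (c Level.⊔ ℓ) where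
    field
      lower    : ∀ i j → i < j → t i j ≈ 0#
      diagonal : ∀ i → t i i ≈ 1#

  shift-unitriangular : ∀ {t} → Unitriangular t → Unitriangular (shift t)
  shift-unitriangular u = record
    { lower    = λ i j i<j → lower (suc i) (suc j) (s≤s i<j)
    ; diagonal = diagonal ∘ suc
    }
    where open Unitriangular u

  alternatingRowSum : (ℕ → ℕ → Carrier) → (ℕ → Carrier) → ℕ → Carrier
  alternatingRowSum t a n = sumBelow R (λ j → negOnePow R (n ∸ j) * (t n j * a j)) (suc n)

  alternatingRowSum-cong : ∀ t {a b} → (∀ j → a j ≈ b j) → ∀ n →
                           alternatingRowSum t a n ≈ alternatingRowSum t b n
  alternatingRowSum-cong t a≈b n = sumBelow-cong (suc n) (λ j _ → *-cong refl (*-cong refl (a≈b j)))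

  alternatingRowSum-suc : ∀ t a n →
    alternatingRowSum t a (suc n) ≈
    negOnePow R (suc n) * (t (suc n) 0 * a 0) + alternatingRowSum (shift t) (a ∘ suc) n
  alternatingRowSum-suc t a n = sumBelow-suc-head _ (suc n)

  alternatingRowSum-injective : ∀ {t a b} → (∀ i → t i i ≈ 1#) →
    (∀ n → alternatingRowSum t a n ≈ alternatingRowSum t b n) → ∀ n → a n ≈ b n
  alternatingRowSum-injective {t} {a} {b} diagonal sums≈ = <-rec _ step
    where
    term : (ℕ → Carrier) → ℕ → ℕ → Carrier
    term x n j = negOnePow R (n ∸ j) * (t n j * x j)

    diagonalTerm : ∀ x n → term x n n ≈ x n
    diagonalTerm x n = begin
      negOnePow R (n ∸ n) * (t n n * x n) ≈⟨ *-cong (reflexive (cong (negOnePow R) (n∸n≡0 n))) refl ⟩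
      1# * (t n n * x n)                  ≈⟨ *-identityˡ _ ⟩
      t n n * x n                         ≈⟨ *-cong (diagonal n) refl ⟩
      1# * x n                            ≈⟨ *-identityˡ _ ⟩
      x n                                 ∎

    step : ∀ n → (∀ {m} → m < n → a m ≈ b m) → a n ≈ b n
    step n ih = begin
      a n         ≈⟨ diagonalTerm a n ⟨
      term a n n  ≈⟨ ∙-cancelˡ _ _ _ (trans (sums≈ n) (+-cong (sym earlier≈) refl)) ⟩
      term b n n  ≈⟨ diagonalTerm b n ⟩
      b n         ∎
      where
      earlier≈ : sumBelow R (term a n) n ≈ sumBelow R (term b n) n
      earlier≈ = sumBelow-cong n (λ j j<n → *-cong refl (*-cong refl (ih j<n)))

  shiftedDet : (ℕ → ℕ → Carrier) → ℕ → Carrier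
  shiftedDet t n = det R n (shiftedBlock R t n)

  withFirstColumn : (ℕ → Carrier) → (ℕ → ℕ → Carrier) → (n : ℕ) → Fin n → Fin n → Carrier
  withFirstColumn a t n i fzero    = a (toℕ i)
  withFirstColumn a t n i (fsuc j) = t (suc (toℕ i)) (suc (toℕ j))

  detWithFirstColumn : (ℕ → Carrier) → (ℕ → ℕ → Carrier) → ℕ → Carrier
  detWithFirstColumn a t n = det R n (withFirstColumn a t n)

  firstColumn : (ℕ → ℕ → Carrier) → ℕ → Carrier
  firstColumn t i = t (suc i) 0

  shiftedDet≈detWithFirstColumn : ∀ t n → shiftedDet t n ≈ detWithFirstColumn (firstColumn t) t n
  shiftedDet≈detWithFirstColumn t n = det-cong n entries≈
    where
    entries≈ : ∀ i j → shiftedBlock R t n i j ≈ withFirstColumn (firstColumn t) t n i j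
    entries≈ i fzero    = refl
    entries≈ i (fsuc j) = refl

  detWithFirstColumn-1 : ∀ a t → detWithFirstColumn a t 1 ≈ a 0
  detWithFirstColumn-1 a t = trans (+-identityʳ _) (trans (*-identityˡ _) (*-identityʳ _))

  -- First-row expansion: the row is (a 0, t 1 1, t 1 2, …) = (a 0, 1, 0, …).
  detWithFirstColumn-suc : ∀ {t} → Unitriangular t → ∀ a n →
    detWithFirstColumn a t (suc (suc n)) ≈
    a 0 * shiftedDet (shift t) (suc n) + - detWithFirstColumn (a ∘ suc) (shift t) (suc n)
  detWithFirstColumn-suc {t} u a n =
    +-cong (*-identityˡ _) (trans (+-cong secondTerm laterTerms) (+-identityʳ _))
    where
    open Unitriangular u
    A = withFirstColumn a t (suc (suc n))

    minor₁≈ : ∀ i k → A (fsuc i) (punchIn (fsuc fzero) k) ≈ withFirstColumn (a ∘ suc) (shift t) (suc n) i k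
    minor₁≈ i fzero    = refl
    minor₁≈ i (fsuc k) = refl

    secondTerm : - 1# * (t 1 1 * det R (suc n) (λ i k → A (fsuc i) (punchIn (fsuc fzero) k))) ≈
                 - detWithFirstColumn (a ∘ suc) (shift t) (suc n)
    secondTerm = begin
      - 1# * (t 1 1 * _)                                   ≈⟨ -‿distribˡ-* _ _ ⟨
      - (1# * (t 1 1 * _))                                 ≈⟨ -‿cong (*-identityˡ _) ⟩
      - (t 1 1 * _)                                        ≈⟨ -‿cong (*-cong (diagonal 1) (det-cong (suc n) minor₁≈)) ⟩
      - (1# * detWithFirstColumn (a ∘ suc) (shift t) (suc n)) ≈⟨ -‿cong (*-identityˡ _) ⟩
      - detWithFirstColumn (a ∘ suc) (shift t) (suc n)     ∎

    laterTerms : sumFin R n (λ j → negOnePow R (toℕ (fsuc (fsuc j))) *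
                   (A fzero (fsuc (fsuc j)) * det R (suc n) (λ i k → A (fsuc i) (punchIn (fsuc (fsuc j)) k)))) ≈ 0#
    laterTerms = sumFin-zero n λ j →
      trans (*-cong refl (trans (*-cong (lower 1 (suc (suc (toℕ j))) (s≤s (s≤s z≤n))) refl) (zeroˡ _)))
            (zeroʳ _)

  alternatingRowSum-detWithFirstColumn-suc : ∀ {t} → Unitriangular t → ∀ n a →
    alternatingRowSum (shift t) (detWithFirstColumn a t ∘ suc) (suc n) ≈
    a 0 * alternatingRowSum (shift t) (shiftedDet (shift t)) (suc n) +
      - alternatingRowSum (shift (shift t)) (detWithFirstColumn (a ∘ suc) (shift t) ∘ suc) n
  alternatingRowSum-detWithFirstColumn-suc {t} u n a = begin
    alternatingRowSum t′ (D ∘ suc) (suc n)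
      ≈⟨ alternatingRowSum-suc t′ (D ∘ suc) n ⟩
    e * (v 0 * D 1) + sumBelow R (λ j → eₙ j * (v (suc j) * D (suc (suc j)))) (suc n)
      ≈⟨ +-cong firstTerm (sumBelow-cong (suc n) λ j _ →
           trans (*-cong refl (*-cong refl (detWithFirstColumn-suc u a j))) (separate (eₙ j) (v (suc j)) _ _)) ⟩
    a 0 * (e * (v 0 * 1#)) + sumBelow R (λ j → a 0 * (eₙ j * (v (suc j) * W (suc j))) + - (eₙ j * (v (suc j) * D′ (suc j)))) (suc n)
      ≈⟨ +-cong refl (trans (sumBelow-distrib-+ _ _ (suc n))
                            (+-cong (sym (*-distribˡ-sumBelow (a 0) _ (suc n))) (sym (-‿distrib-sumBelow _ (suc n))))) ⟩
    a 0 * (e * (v 0 * 1#)) + (a 0 * alternatingRowSum (shift t′) (W ∘ suc) n + - alternatingRowSum (shift t′) (D′ ∘ suc) n)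
      ≈⟨ trans (sym (+-assoc _ _ _)) (+-cong (sym (distribˡ (a 0) _ _)) refl) ⟩
    a 0 * (e * (v 0 * 1#) + alternatingRowSum (shift t′) (W ∘ suc) n) + - alternatingRowSum (shift t′) (D′ ∘ suc) n
      ≈⟨ +-cong (*-cong refl (alternatingRowSum-suc t′ W n)) refl ⟨
    a 0 * alternatingRowSum t′ W (suc n) + - alternatingRowSum (shift t′) (D′ ∘ suc) n ∎
    where
    t′ = shift t
    D  = detWithFirstColumn a t
    D′ = detWithFirstColumn (a ∘ suc) t′
    W  = shiftedDet t′
    e  = negOnePow R (suc n)
    eₙ = λ j → negOnePow R (n ∸ j)
    v  = t′ (suc n)

    firstTerm : e * (v 0 * D 1) ≈ a 0 * (e * (v 0 * 1#))
    firstTerm = begin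
      e * (v 0 * D 1)          ≈⟨ *-cong refl (*-cong refl (trans (detWithFirstColumn-1 a t) (sym (*-identityʳ _)))) ⟩
      e * (v 0 * (a 0 * 1#))   ≈⟨ *-cong refl (x∙yz≈y∙xz _ _ _) ⟩
      e * (a 0 * (v 0 * 1#))   ≈⟨ x∙yz≈y∙xz _ _ _ ⟩
      a 0 * (e * (v 0 * 1#))   ∎

    separate : ∀ x y w d → x * (y * (a 0 * w + - d)) ≈ a 0 * (x * (y * w)) + - (x * (y * d))
    separate x y w d = begin
      x * (y * (a 0 * w + - d))           ≈⟨ *-cong refl (distribˡ y _ _) ⟩
      x * (y * (a 0 * w) + y * - d)       ≈⟨ distribˡ x _ _ ⟩
      x * (y * (a 0 * w)) + x * (y * - d) ≈⟨ +-cong (trans (*-cong refl (x∙yz≈y∙xz y (a 0) w)) (x∙yz≈y∙xz x (a 0) _))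
                                                    (trans (*-cong refl (sym (-‿distribʳ-* y d))) (sym (-‿distribʳ-* x _))) ⟩
      a 0 * (x * (y * w)) + - (x * (y * d)) ∎

  mutual
    alternatingRowSum-shiftedDet-suc : ∀ {t} → Unitriangular t → ∀ n →
                                       alternatingRowSum t (shiftedDet t) (suc n) ≈ 0#
    alternatingRowSum-shiftedDet-suc {t} u n = begin
      alternatingRowSum t (shiftedDet t) (suc n)
        ≈⟨ alternatingRowSum-suc t (shiftedDet t) n ⟩
      negOnePow R (suc n) * (t (suc n) 0 * 1#) + alternatingRowSum (shift t) (shiftedDet t ∘ suc) n
        ≈⟨ +-cong (*-cong refl (*-identityʳ _)) (alternatingRowSum-cong (shift t) (shiftedDet≈detWithFirstColumn t ∘ suc) n) ⟩
      - negOnePow R n * t (suc n) 0 + alternatingRowSum (shift t) (detWithFirstColumn (firstColumn t) t ∘ suc) n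
        ≈⟨ +-cong (sym (-‿distribˡ-* _ _)) (alternatingRowSum-detWithFirstColumn u n (firstColumn t)) ⟩
      - (negOnePow R n * t (suc n) 0) + negOnePow R n * t (suc n) 0
        ≈⟨ -‿inverseˡ _ ⟩
      0# ∎

    alternatingRowSum-detWithFirstColumn : ∀ {t} → Unitriangular t → ∀ n a →
      alternatingRowSum (shift t) (detWithFirstColumn a t ∘ suc) n ≈ negOnePow R n * a n
    alternatingRowSum-detWithFirstColumn {t} u zero a =
      trans (+-identityˡ _) (*-cong refl (trans (*-cong (diagonal 1) (detWithFirstColumn-1 a t)) (*-identityˡ _)))
      where open Unitriangular u
    alternatingRowSum-detWithFirstColumn {t} u (suc n) a = begin
      alternatingRowSum (shift t) (detWithFirstColumn a t ∘ suc) (suc n)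
        ≈⟨ alternatingRowSum-detWithFirstColumn-suc u n a ⟩
      a 0 * alternatingRowSum (shift t) (shiftedDet (shift t)) (suc n) +
        - alternatingRowSum (shift (shift t)) (detWithFirstColumn (a ∘ suc) (shift t) ∘ suc) n
        ≈⟨ +-cong (*-cong refl (alternatingRowSum-shiftedDet-suc u′ n))
                  (-‿cong (alternatingRowSum-detWithFirstColumn u′ n (a ∘ suc))) ⟩
      a 0 * 0# + - (negOnePow R n * a (suc n))
        ≈⟨ trans (+-cong (zeroʳ _) (-‿distribˡ-* _ _)) (+-identityˡ _) ⟩
      negOnePow R (suc n) * a (suc n) ∎
      where u′ = shift-unitriangular u

  alternatingRowSum-shiftedDet : ∀ {t} → Unitriangular t → ∀ n →
                                 alternatingRowSum t (shiftedDet t) n ≈ iverZero R n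
  alternatingRowSum-shiftedDet u zero    =
    trans (+-identityˡ _) (trans (*-identityˡ _) (trans (*-identityʳ _) (Unitriangular.diagonal u 0)))
  alternatingRowSum-shiftedDet u (suc n) = alternatingRowSum-shiftedDet-suc u n

lemma1 : {c ℓ : Level} (R : CommutativeRing c ℓ) →
           let open CommutativeRing R in
           (t : ℕ → ℕ → Carrier) (M : ℕ → Carrier) →
           (∀ i j → i < j → t i j ≈ 0#) →
           (∀ i → t i i ≈ 1#) →
           (∀ n → ¬ (M n ≈ 0#)) →
           (∀ n → sumBelow R (λ j → negOnePow R (n ∸ j) * (t n j * M j)) (suc n) ≈ iverZero R n) →
           ∀ n → 1 ≤ n → det R n (shiftedBlock R t n) ≈ M n
lemma1 R t M lower diagonal _ recursion n _ =
  alternatingRowSum-injective diagonal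
    (λ k → trans (alternatingRowSum-shiftedDet unitriangular k) (sym (recursion k))) n
  where
  open CommutativeRing R using (trans; sym)
  open HessenbergDeterminants R
  unitriangular : Unitriangular t
  unitriangular = record { lower = lower ; diagonal = diagonal }
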